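{- Let $n$ be a positive integer, let $a\in[n]$, $U\subseteq[n]$, and let $V$ be a subset of $[n]$ with $V\neq\varnothing$ and $V\neq[n]$. Then $\langle a,U\rangle\mathrel{D}\langle V\rangle$ holds in the lattice $\mathrm{Bip}(n)$, where $\langle a,U\rangle=(\{a\}\cup([n]\setminus U))\times(\{a\}\cup U)$ and $\langle V\rangle=([n]\setminus V)\times V$.
   Context: $[n]=\{1,\dots,n\}$. $\mathrm{Bip}(n)$ is the set of bipartitions of $[n]$, i.e. transitive relations $\mathbf{x}\subseteq[n]\times[n]$ whose complement $([n]\times[n])\setminus\mathbf{x}$ is also transitive, ordered by inclusion; it is a lattice whose join is the transitive closure of the union and whose meet of $\mathbf{x},\mathbf{y}$ is the largest subset of $\mathbf{x}\cap\mathbf{y}$ with transitive complement. The sets $\langle a,U\rangle$ and $\langle V\rangle$ as in the claim are join-irreducible in $\mathrm{Bip}(n)$. The join-dependency relation $D$ on join-irreducible elements of a finite lattice $L$: $p\mathrel{D}q$ iff $p\neq q$ and there exists $x\in L$ with $p\le q\vee x$ and $p\not\le q_*\vee x$, where $q_*$ is the unique lower cover of $q$. -}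

module Defs where

open import Data.Bool using (Bool; true; false; _∧_; _∨_; not)
open import Data.Fin using (Fin; _≟_)
open import Data.Fin.Subset using (Subset)
open import Data.Vec using (lookup)
open import Data.Nat using (ℕ)
open import Data.Product using (Σ; _×_)
open import Data.Sum using (_⊎_)
open import Relation.Nullary using (¬_)
open import Relation.Nullary.Decidable using (⌊_⌋)
open import Relation.Binary.PropositionalEquality using (_≡_)
open import Relation.Binary.Construct.Closure.Transitive using (TransClosure)

-- A (decidable) binary relation on [n] = Fin n, i.e. a subset of [n] × [n].
BRel : ℕ → Set
BRel n = Fin n → Fin n → Bool

_⊆ᵣ_ : ∀ {n} → BRel n → BRel n → Set
x ⊆ᵣ y = ∀ i j → x i j ≡ true → y i j ≡ true

compl : ∀ {n} → BRel n → BRel n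
compl x i j = not (x i j)

IsTransitive : ∀ {n} → BRel n → Set
IsTransitive x = ∀ i j k → x i j ≡ true → x j k ≡ true → x i k ≡ true

IsBip : ∀ {n} → BRel n → Set
IsBip x = IsTransitive x × IsTransitive (compl x)

-- Join in Bip(n): transitive closure of the union (as a predicate on pairs).
Join : ∀ {n} → BRel n → BRel n → Fin n → Fin n → Set
Join x y = TransClosure (λ i j → (x i j ∨ y i j) ≡ true)

_≤Join_,_ : ∀ {n} → BRel n → BRel n → BRel n → Set
p ≤Join x , y = ∀ i j → p i j ≡ true → Join x y i j

IsLowerCover : ∀ {n} → BRel n → BRel n → Set
IsLowerCover {n} c q =
  IsBip c × c ⊆ᵣ q × ¬ (q ⊆ᵣ c) ×
  (∀ (z : BRel n) → IsBip z → c ⊆ᵣ z → z ⊆ᵣ q → z ⊆ᵣ c ⊎ q ⊆ᵣ z)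

-- Join-dependency p D q in Bip(n): p ≠ q and, with q_* the (unique) lower
-- cover of q, there is x ∈ Bip(n) with p ≤ q ∨ x and p ≰ q_* ∨ x.
_D_ : ∀ {n} → BRel n → BRel n → Set
_D_ {n} p q =
  ¬ (∀ i j → p i j ≡ q i j) ×
  Σ (BRel n) λ qₗ → IsLowerCover qₗ q ×
    Σ (BRel n) λ x → IsBip x × (p ≤Join q , x) × ¬ (p ≤Join qₗ , x)

⟨_,_⟩ : ∀ {n} → Fin n → Subset n → BRel n
⟨ a , U ⟩ i j = (⌊ i ≟ a ⌋ ∨ not (lookup U i)) ∧ (⌊ j ≟ a ⌋ ∨ lookup U j)

⟨_⟩ : ∀ {n} → Subset n → BRel n
⟨ V ⟩ i j = not (lookup V i) ∧ lookup V j

module Submission where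

-- The bipartition q = ⟨V⟩ = ([n]∖V) × V is an atom of Bip(n):
-- a relation z ⊆ ⟨V⟩ with transitive complement is "co-transitive"
-- (z i k forces z i j or z j k for every j), and this spreads a single pair
-- of z over the whole of ⟨V⟩.  Hence q_* is the empty relation ∅.
-- As witness x we take the complementary bipartition ⟨∁V⟩ = V × ([n]∖V).
--  * Every pair (i , j) is a single step of ⟨V⟩ ∪ ⟨∁V⟩ when i, j lie on
--    different sides of V, and a two-step path through a point on the other
--    side otherwise; as V and [n]∖V are both nonempty, q ∨ x is everything,
--    so p ≤ q ∨ x for p = ⟨a,U⟩.
--  * ∅ ∨ x = x since x is transitive, and x is irreflexive, whereas p
--    contains the diagonal pair (a , a); so p ≰ ∅ ∨ x.  The same pair shows
--    p ≠ q, since q is irreflexive too.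

open import Defs
open import Data.Nat using (ℕ; _≤_)
open import Data.Fin using (Fin; _≟_)
open import Data.Fin.Subset using (Subset; Nonempty; ⊤; ∁; _∈_)
open import Data.Fin.Subset.Properties using (_∈?_; ⊆-antisym; ⊆⊤)
open import Data.Fin.Properties using (any?; ¬∀⟶∃¬)
open import Data.Bool using (Bool; true; false; _∧_; _∨_; not)
import Data.Bool as Bool
open import Data.Bool.Properties using (not-involutive; ¬-not)
open import Data.Vec using (lookup)
open import Data.Vec.Properties using ([]=⇒lookup; lookup⇒[]=; lookup-map)
-- The pair constructor is renamed to _⸴_ so that ⟨ a , U ⟩ parses unambiguously.
open import Data.Product using (∃; _×_; proj₁; proj₂) renaming (_,_ to _⸴_)
open import Data.Sum using (_⊎_; inj₁; inj₂)
open import Data.Empty using (⊥-elim)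
open import Relation.Nullary using (¬_; yes; no)
open import Relation.Nullary.Decidable using (isYes≗does; dec-true)
open import Relation.Binary.PropositionalEquality using (_≡_; _≢_; refl; sym; trans; cong)
open import Relation.Binary.Construct.Closure.Transitive using ([_]; _∷_; transitive⁻)

private
  variable
    n : ℕ

false≢true : false ≢ true
false≢true ()

⟨⟩-sides : (W : Subset n) (i j : Fin n) →
           ⟨ W ⟩ i j ≡ true → lookup W i ≡ false × lookup W j ≡ true
⟨⟩-sides W i j e with lookup W i | lookup W j
⟨⟩-sides W i j refl | false | true = refl ⸴ refl

⟨⟩-irreflexive : (W : Subset n) (i : Fin n) → ⟨ W ⟩ i i ≡ false
⟨⟩-irreflexive W i with lookup W i
... | true  = refl
... | false = refl

¬⟨⟩-transitive : (a b c : Bool) → not (not a ∧ b) ≡ true → not (not b ∧ c) ≡ true →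
                 not (not a ∧ c) ≡ true
¬⟨⟩-transitive true  _     _     _  _  = refl
¬⟨⟩-transitive false _     false _  _  = refl
¬⟨⟩-transitive false false true  _  ()
¬⟨⟩-transitive false true  true  () _

-- Every ⟨W⟩ is a bipartition; its composition with itself is even empty.
⟨⟩-bip : (W : Subset n) → IsBip ⟨ W ⟩
⟨⟩-bip W = transitive ⸴ compl-transitive
  where
    transitive : IsTransitive ⟨ W ⟩
    transitive i j k ij jk =
      ⊥-elim (false≢true (trans (sym (proj₁ (⟨⟩-sides W j k jk)))
                                 (proj₂ (⟨⟩-sides W i j ij))))
    compl-transitive : IsTransitive (compl ⟨ W ⟩)
    compl-transitive i j k = ¬⟨⟩-transitive (lookup W i) (lookup W j) (lookup W k)

co-transitive : (z : BRel n) → IsTransitive (compl z) →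
                ∀ i j k → z i k ≡ true → z i j ≡ true ⊎ z j k ≡ true
co-transitive z ¬z-trans i j k zik with z i j in ij | z j k in jk
... | true  | _     = inj₁ refl
... | false | true  = inj₂ refl
... | false | false =
  ⊥-elim (false≢true (trans (cong not (sym zik))
                            (¬z-trans i j k (cong not ij) (cong not jk))))

⟨⟩-atom : (W : Subset n) (z : BRel n) → IsTransitive (compl z) → z ⊆ᵣ ⟨ W ⟩ →
          ∀ i k → z i k ≡ true → ⟨ W ⟩ ⊆ᵣ z
⟨⟩-atom W z ¬z-trans z⊆⟨W⟩ i k zik j l ⟨W⟩jl
  with ⟨⟩-sides W j l ⟨W⟩jl | co-transitive z ¬z-trans i j k zik
... | j∉W ⸴ _ | inj₁ zij =
  ⊥-elim (false≢true (trans (sym j∉W) (proj₂ (⟨⟩-sides W i j (z⊆⟨W⟩ i j zij)))))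
... | _ ⸴ l∈W | inj₂ zjk with co-transitive z ¬z-trans j l k zjk
...   | inj₁ zjl = zjl
...   | inj₂ zlk =
  ⊥-elim (false≢true (trans (sym (proj₁ (⟨⟩-sides W l k (z⊆⟨W⟩ l k zlk)))) l∈W))

∅ᵣ : BRel n
∅ᵣ _ _ = false

-- The empty relation is the lower cover of any nonempty atom q of Bip(n);
-- covering needs a decision whether a candidate z is empty.
∅-lowerCover : (q : BRel n) (i j : Fin n) → q i j ≡ true →
               (∀ z → IsBip z → z ⊆ᵣ q → ∀ i k → z i k ≡ true → q ⊆ᵣ z) →
               IsLowerCover ∅ᵣ q
∅-lowerCover {n} q i j qij atom =
  ∅-bip ⸴ (λ _ _ ()) ⸴ (λ q⊆∅ → false≢true (q⊆∅ i j qij)) ⸴ covers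
  where
    ∅-bip : IsBip {n} ∅ᵣ
    ∅-bip = (λ _ _ _ ()) ⸴ (λ _ _ _ _ _ → refl)
    covers : ∀ z → IsBip z → ∅ᵣ ⊆ᵣ z → z ⊆ᵣ q → z ⊆ᵣ ∅ᵣ ⊎ q ⊆ᵣ z
    covers z z-bip _ z⊆q with any? (λ k → any? (λ l → z k l Bool.≟ true))
    ... | yes (k ⸴ l ⸴ zkl) = inj₂ (atom z z-bip z⊆q k l zkl)
    ... | no  z-empty       = inj₁ (λ k l zkl → ⊥-elim (z-empty (k ⸴ l ⸴ zkl)))

∅-join : (x : BRel n) → IsTransitive x → ∀ i j → Join ∅ᵣ x i j → x i j ≡ true
∅-join x x-trans i j = transitive⁻ _ (λ {i} {j} {k} → x-trans i j k)

⟨∁⟩-pairs : (W : Subset n) (i j : Fin n) →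
            ⟨ ∁ W ⟩ i j ≡ lookup W i ∧ not (lookup W j)
⟨∁⟩-pairs W i j
  rewrite lookup-map i not W | lookup-map j not W | not-involutive (lookup W i)
  = refl

separated-step : (W : Subset n) (i j : Fin n) → lookup W i ≢ lookup W j →
                 (⟨ W ⟩ i j ∨ ⟨ ∁ W ⟩ i j) ≡ true
separated-step W i j i≁j rewrite ⟨∁⟩-pairs W i j with lookup W i | lookup W j
... | false | true  = refl
... | true  | false = refl
... | false | false = ⊥-elim (i≁j refl)
... | true  | true  = ⊥-elim (i≁j refl)

-- If W and [n]∖W are both inhabited, ⟨W⟩ ∨ ⟨∁W⟩ is the full relation:
-- points on different sides are one step apart, points on the same side
-- are joined through a point of the other side.
⟨⟩-join-⟨∁⟩ : (W : Subset n) (v w : Fin n) → lookup W v ≡ true → lookup W w ≡ false →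
              ∀ i j → Join ⟨ W ⟩ ⟨ ∁ W ⟩ i j
⟨⟩-join-⟨∁⟩ W v w v∈W w∉W i j with lookup W i Bool.≟ lookup W j
... | no  i≁j = [ separated-step W i j i≁j ]
... | yes i∼j =
  separated-step W i k (λ i∼k → k≁i (sym i∼k))
    ∷ [ separated-step W k j (λ k∼j → k≁i (trans k∼j (sym i∼j))) ]
  where
    other-side : ∃ λ k → lookup W k ≢ lookup W i
    other-side with lookup W i
    ... | true  = w ⸴ λ w∈W → false≢true (trans (sym w∉W) w∈W)
    ... | false = v ⸴ λ v∉W → false≢true (trans (sym v∉W) v∈W)
    k : Fin _
    k = proj₁ other-side
    k≁i : lookup W k ≢ lookup W i
    k≁i = proj₂ other-side

outside-point : (W : Subset n) → W ≢ ⊤ → ∃ λ w → lookup W w ≡ false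
outside-point {n} W W≢⊤
  with ¬∀⟶∃¬ n (_∈ W) (_∈? W) (λ all∈W → W≢⊤ (⊆-antisym ⊆⊤ (λ {k} _ → all∈W k)))
... | w ⸴ w∉W = w ⸴ ¬-not (λ w∈W → w∉W (lookup⇒[]= w W w∈W))

⟨,⟩-diagonal : (a : Fin n) (U : Subset n) → ⟨ a , U ⟩ a a ≡ true
⟨,⟩-diagonal a U rewrite isYes≗does (a ≟ a) | dec-true (a ≟ a) refl = refl

lemma8p2 : ∀ (n : ℕ) → 1 ≤ n → (a : Fin n) (U V : Subset n) →
    Nonempty V → V ≢ ⊤ → ⟨ a , U ⟩ D ⟨ V ⟩
lemma8p2 n _ a U V (v ⸴ v∈V) V≢⊤ =
    p≢q
  ⸴ ∅ᵣ ⸴ ∅-lowerCover ⟨ V ⟩ w v ⟨V⟩wv atom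
  ⸴ ⟨ ∁ V ⟩ ⸴ ⟨⟩-bip (∁ V)
  ⸴ (λ i j _ → ⟨⟩-join-⟨∁⟩ V v w ([]=⇒lookup v∈V) w∉V i j)
  ⸴ p≰∅∨x
  where
    w : Fin n
    w = proj₁ (outside-point V V≢⊤)
    w∉V : lookup V w ≡ false
    w∉V = proj₂ (outside-point V V≢⊤)
    ⟨V⟩wv : ⟨ V ⟩ w v ≡ true
    ⟨V⟩wv rewrite w∉V | []=⇒lookup v∈V = refl
    atom : ∀ z → IsBip z → z ⊆ᵣ ⟨ V ⟩ → ∀ i k → z i k ≡ true → ⟨ V ⟩ ⊆ᵣ z
    atom z (_ ⸴ ¬z-trans) = ⟨⟩-atom V z ¬z-trans
    -- (a , a) lies in p but neither in q nor in ∅ ∨ ⟨∁V⟩ = ⟨∁V⟩.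
    p≢q : ¬ (∀ i j → ⟨ a , U ⟩ i j ≡ ⟨ V ⟩ i j)
    p≢q p≡q = false≢true (trans (sym (⟨⟩-irreflexive V a))
                                (trans (sym (p≡q a a)) (⟨,⟩-diagonal a U)))
    p≰∅∨x : ¬ (⟨ a , U ⟩ ≤Join ∅ᵣ , ⟨ ∁ V ⟩)
    p≰∅∨x p≤ = false≢true (trans (sym (⟨⟩-irreflexive (∁ V) a))
      (∅-join ⟨ ∁ V ⟩ (proj₁ (⟨⟩-bip (∁ V))) a a (p≤ a a (⟨,⟩-diagonal a U))))
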